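{- For every positive integer $m$, $R_{2m,2m}=2R_{m,m}$. In particular $R_{m,m}$ and $R_{2m,2m}$ are similar figures.
   Context: For a positive integer $m$, the chocolate game $C_{m,m}$ is a two-player impartial game on an $m\times m$ chocolate bar of unit cells, exactly one of which is poisoned (known to both players); cells are $(i,j)\in\mathbb{Z}^2$ with $1\le i,j\le m$. Players alternately break the current bar along a grid line into two rectangular pieces, eat one and pass the other (always keeping the poisoned cell); a player who receives the $1\times1$ bar loses. A cell $(i,j)$ is a P-position if with poison at $(i,j)$ the second player has a winning strategy; $P_{m,m}$ denotes the set of P-positions. It is known that $(i,j)\in P_{m,m}$ iff $(i-1)\oplus(j-1)\oplus(m-i)\oplus(m-j)=0$ ($\oplus$ = bitwise XOR). The pattern is $R_{m,m}=\{(i-x,j-y)\in\mathbb{R}^2: 0\le x,y\le1,\ (i,j)\in P_{m,m}\}$, and for $A\subset\mathbb{R}^2$, $r\in\mathbb{R}$, $rA=\{(rx,ry):(x,y)\in A\}$.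
   Formalization: The plane carrying $R_{m,m}$, $R_{2m,2m}$ and $2R_{m,m}$ is ℚ² instead of $\mathbb{R}^2$, and the offsets $x,y$ are rational. -}

module Defs where

open import Data.Bool.Base using (Bool; true; false; if_then_else_) renaming (_xor_ to _xorᵇ_)
open import Data.Nat.Base using (ℕ; zero; suc; _+_; _*_; _∸_; _≤_; _%_; _/_; _≡ᵇ_)
open import Data.Integer.Base using (+_)
open import Data.Rational.Base as ℚ using (ℚ; 0ℚ; 1ℚ)
open import Data.Product using (_×_; _,_; ∃-syntax)
open import Relation.Binary.PropositionalEquality using (_≡_)

bit0 : ℕ → Bool
bit0 n = (n % 2) ≡ᵇ 1

-- bitwise XOR with fuel; fuel a + b suffices since each step halves
xorFuel : ℕ → ℕ → ℕ → ℕ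
xorFuel zero    a b = 0
xorFuel (suc k) a b =
  (if bit0 a xorᵇ bit0 b then 1 else 0) + 2 * xorFuel k (a / 2) (b / 2)

_⊕_ : ℕ → ℕ → ℕ
a ⊕ b = xorFuel (a + b) a b

infixl 6 _⊕_

InP : ℕ → ℕ → ℕ → Set
InP m i j =
  (1 ≤ i) × (i ≤ m) × (1 ≤ j) × (j ≤ m) ×
  ((i ∸ 1) ⊕ (j ∸ 1) ⊕ (m ∸ i) ⊕ (m ∸ j) ≡ 0)

ℕ→ℚ : ℕ → ℚ
ℕ→ℚ n = + n ℚ./ 1

Point : Set
Point = ℚ × ℚ

R : ℕ → Point → Set
R m (u , v) = ∃[ i ] ∃[ j ] ∃[ x ] ∃[ y ]
  InP m i j × (0ℚ ℚ.≤ x) × (x ℚ.≤ 1ℚ) × (0ℚ ℚ.≤ y) × (y ℚ.≤ 1ℚ) ×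
  (u ≡ ℕ→ℚ i ℚ.- x) × (v ≡ ℕ→ℚ j ℚ.- y)

scale : ℚ → (Point → Set) → Point → Set
scale r A (u , v) = ∃[ x ] ∃[ y ] A (x , y) × (u ≡ r ℚ.* x) × (v ≡ r ℚ.* y)

-- Write a cell index of the 2m-board as i = 2a + 1 + e with a bit e, so that cell i is one
-- of the two halves of cell a + 1 of the m-board.  The four heaps i-1, j-1, 2m-i, 2m-j of
-- cell (i , j) then have lowest bits e, f, 1-e, 1-f, which cancel in the nim-sum, and
-- their halves are exactly the heaps a, b, m-1-a, m-1-b of the parent cell (a+1 , b+1).
-- So the nim-sum on the 2m-board is twice the one on the m-board, all four cells of the
-- 2×2 block over a parent have the same P-status as the parent, and these four unit
-- squares tile the parent's unit square scaled by 2.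
module Submission where

open import Defs
open import Data.Bool.Base using (Bool; true; false; not; if_then_else_; _xor_)
open import Data.Nat.Base
open import Data.Nat.Properties
open import Data.Nat.DivMod using (_/_; m/n≤m; m/n<m; /-monoˡ-≤; %-remove-+ʳ; +-distrib-/-∣ʳ; m*n/n≡m)
open import Data.Nat.Divisibility using (m∣m*n)
import Data.Integer.Base as ℤ
import Data.Integer.Properties as ℤ
open import Data.Rational.Base as ℚ using (ℚ; 0ℚ; 1ℚ; ½)
import Data.Rational.Properties as ℚₚ
import Data.Rational.Unnormalised.Base as ℚᵘ
import Data.Rational.Unnormalised.Properties as ℚᵘₚ
open import Data.Product using (_×_; _,_; ∃-syntax)
open import Function.Bundles using (_⇔_; mk⇔; Equivalence)
open import Level using (0ℓ)
open import Relation.Nullary.Decidable using (yes; no; dec⇒maybe)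
open import Relation.Binary.PropositionalEquality
open import Tactic.RingSolver using (solve-∀)
open import Tactic.RingSolver.Core.AlmostCommutativeRing using (AlmostCommutativeRing; fromCommutativeRing)

bit : Bool → ℕ
bit b = if b then 1 else 0

bit+double-surjective : ∀ n → ∃[ e ] ∃[ a ] n ≡ bit e + 2 * a
bit+double-surjective zero = false , 0 , refl
bit+double-surjective (suc n) with bit+double-surjective n
... | false , a , refl = true , a , refl
... | true  , a , refl = false , suc a , sym (*-suc 2 a)

bit0-bit+double : ∀ e a → bit0 (bit e + 2 * a) ≡ e
bit0-bit+double e a = trans (cong (_≡ᵇ 1) (%-remove-+ʳ (bit e) (m∣m*n a))) (bit0-bit e)
  where
  bit0-bit : ∀ e → bit0 (bit e) ≡ e
  bit0-bit false = refl
  bit0-bit true  = refl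

bit+double/2 : ∀ e a → (bit e + 2 * a) / 2 ≡ a
bit+double/2 e a = begin
  (bit e + 2 * a) / 2     ≡⟨ +-distrib-/-∣ʳ (bit e) (m∣m*n a) ⟩
  bit e / 2 + 2 * a / 2   ≡⟨ cong₂ _+_ (bit/2 e) (cong (_/ 2) (*-comm 2 a)) ⟩
  a * 2 / 2               ≡⟨ m*n/n≡m a 2 ⟩
  a                       ∎
  where
  open ≡-Reasoning
  bit/2 : ∀ e → bit e / 2 ≡ 0
  bit/2 false = refl
  bit/2 true  = refl

half-≤-pred : ∀ {n k} → n ≤ suc k → n / 2 ≤ k
half-≤-pred {n} {k} n≤1+k =
  <⇒≤pred (≤-<-trans (/-monoˡ-≤ 2 n≤1+k) (m/n<m (suc k) 2 (s≤s (s≤s z≤n))))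

xorFuel-suc : ∀ {k a b} → a ≤ k → b ≤ k → xorFuel (suc k) a b ≡ xorFuel k a b
xorFuel-suc {zero}  z≤n z≤n = refl
xorFuel-suc {suc k} {a} {b} a≤1+k b≤1+k =
  cong (λ n → bit (bit0 a xor bit0 b) + 2 * n) (xorFuel-suc (half-≤-pred a≤1+k) (half-≤-pred b≤1+k))

xorFuel≡⊕ : ∀ {k} a b → a + b ≤′ k → xorFuel k a b ≡ a ⊕ b
xorFuel≡⊕ a b (≤′-reflexive refl) = refl
xorFuel≡⊕ a b (≤′-step {n = k} a+b≤′k) =
  trans (xorFuel-suc (≤-trans (m≤m+n a b) a+b≤k) (≤-trans (m≤n+m b a) a+b≤k)) (xorFuel≡⊕ a b a+b≤′k)
  where
  a+b≤k : a + b ≤ k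
  a+b≤k = ≤′⇒≤ a+b≤′k

⊕-unfold : ∀ a b → a ⊕ b ≡ bit (bit0 a xor bit0 b) + 2 * (a / 2 ⊕ b / 2)
⊕-unfold a b = begin
  a ⊕ b                                                          ≡⟨ xorFuel≡⊕ a b (≤′-step ≤′-refl) ⟨
  bit (bit0 a xor bit0 b) + 2 * xorFuel (a + b) (a / 2) (b / 2)  ≡⟨ cong (λ n → bit (bit0 a xor bit0 b) + 2 * n) halves ⟩
  bit (bit0 a xor bit0 b) + 2 * (a / 2 ⊕ b / 2)                  ∎
  where
  open ≡-Reasoning
  halves : xorFuel (a + b) (a / 2) (b / 2) ≡ a / 2 ⊕ b / 2
  halves = xorFuel≡⊕ (a / 2) (b / 2) (≤⇒≤′ (+-mono-≤ (m/n≤m a 2) (m/n≤m b 2)))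

⊕-bit+double : ∀ e f a b → (bit e + 2 * a) ⊕ (bit f + 2 * b) ≡ bit (e xor f) + 2 * (a ⊕ b)
⊕-bit+double e f a b = begin
  x ⊕ y                                          ≡⟨ ⊕-unfold x y ⟩
  bit (bit0 x xor bit0 y) + 2 * (x / 2 ⊕ y / 2)  ≡⟨ cong₂ (λ c n → bit c + 2 * n) lowest-bits halves ⟩
  bit (e xor f) + 2 * (a ⊕ b)                    ∎
  where
  open ≡-Reasoning
  x y : ℕ
  x = bit e + 2 * a
  y = bit f + 2 * b
  lowest-bits : bit0 x xor bit0 y ≡ e xor f
  lowest-bits = cong₂ _xor_ (bit0-bit+double e a) (bit0-bit+double f b)
  halves : x / 2 ⊕ y / 2 ≡ a ⊕ b
  halves = cong₂ _⊕_ (bit+double/2 e a) (bit+double/2 f b)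

⊕-complementary-bits : ∀ e f a b c d →
  (bit e + 2 * a) ⊕ (bit f + 2 * b) ⊕ (bit (not e) + 2 * c) ⊕ (bit (not f) + 2 * d)
    ≡ 2 * (a ⊕ b ⊕ c ⊕ d)
⊕-complementary-bits e f a b c d = begin
  (bit e + 2 * a) ⊕ (bit f + 2 * b) ⊕ z ⊕ w
    ≡⟨ cong (λ n → n ⊕ z ⊕ w) (⊕-bit+double e f a b) ⟩
  (bit (e xor f) + 2 * (a ⊕ b)) ⊕ z ⊕ w
    ≡⟨ cong (_⊕ w) (⊕-bit+double (e xor f) (not e) (a ⊕ b) c) ⟩
  (bit ((e xor f) xor not e) + 2 * (a ⊕ b ⊕ c)) ⊕ w
    ≡⟨ ⊕-bit+double ((e xor f) xor not e) (not f) (a ⊕ b ⊕ c) d ⟩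
  bit (((e xor f) xor not e) xor not f) + 2 * (a ⊕ b ⊕ c ⊕ d)
    ≡⟨ cong (λ g → bit g + 2 * (a ⊕ b ⊕ c ⊕ d)) (xor-complements e f) ⟩
  2 * (a ⊕ b ⊕ c ⊕ d) ∎
  where
  open ≡-Reasoning
  z w : ℕ
  z = bit (not e) + 2 * c
  w = bit (not f) + 2 * d
  xor-complements : ∀ e f → ((e xor f) xor not e) xor not f ≡ false
  xor-complements false false = refl
  xor-complements false true  = refl
  xor-complements true  false = refl
  xor-complements true  true  = refl

child : Bool → ℕ → ℕ
child e a = suc (bit e + 2 * a)

child-surjective : ∀ {i} → 1 ≤ i → ∃[ e ] ∃[ a ] i ≡ child e a
child-surjective {suc i} _ with bit+double-surjective i
... | e , a , i≡ = e , a , cong suc i≡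

child+bit-not : ∀ e a → child e a + bit (not e) ≡ 2 * suc a
child+bit-not false a = trans (+-comm (child false a) 1) (sym (*-suc 2 a))
child+bit-not true  a = trans (+-identityʳ (child true a)) (sym (*-suc 2 a))

child≤double⇔< : ∀ e {m a} → child e a ≤ 2 * m ⇔ a < m
child≤double⇔< e {m} {a} = mk⇔
  (λ child≤2m → *-cancelˡ-< 2 a m (<-≤-trans (s≤s (m≤n+m (2 * a) (bit e))) child≤2m))
  (λ a<m → ≤-trans (m≤m+n (child e a) _) (≤-trans (≤-reflexive (child+bit-not e a)) (*-monoʳ-≤ 2 a<m)))

mirror-child : ∀ e {m a} → a < m → 2 * m ∸ child e a ≡ bit (not e) + 2 * (m ∸ suc a)
mirror-child e {m} {a} a<m = begin
  2 * m ∸ child e a                              ≡⟨ cong (λ n → 2 * n ∸ child e a) (m+[n∸m]≡n a<m) ⟨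
  2 * (suc a + c) ∸ child e a                    ≡⟨ cong (_∸ child e a) double-split ⟩
  child e a + (bit (not e) + 2 * c) ∸ child e a  ≡⟨ m+n∸m≡n (child e a) _ ⟩
  bit (not e) + 2 * c                            ∎
  where
  open ≡-Reasoning
  c : ℕ
  c = m ∸ suc a
  double-split : 2 * (suc a + c) ≡ child e a + (bit (not e) + 2 * c)
  double-split = begin
    2 * (suc a + c)                    ≡⟨ *-distribˡ-+ 2 (suc a) c ⟩
    2 * suc a + 2 * c                  ≡⟨ cong (_+ 2 * c) (child+bit-not e a) ⟨
    child e a + bit (not e) + 2 * c    ≡⟨ +-assoc (child e a) _ _ ⟩
    child e a + (bit (not e) + 2 * c)  ∎

nimSum : ℕ → ℕ → ℕ → ℕ
nimSum m i j = (i ∸ 1) ⊕ (j ∸ 1) ⊕ (m ∸ i) ⊕ (m ∸ j)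

nimSum-child : ∀ e f {m a b} → a < m → b < m →
  nimSum (2 * m) (child e a) (child f b) ≡ 2 * nimSum m (suc a) (suc b)
nimSum-child e f {m} {a} {b} a<m b<m = begin
  nimSum (2 * m) (child e a) (child f b)
    ≡⟨ cong₂ (λ z w → (bit e + 2 * a) ⊕ (bit f + 2 * b) ⊕ z ⊕ w) (mirror-child e a<m) (mirror-child f b<m) ⟩
  (bit e + 2 * a) ⊕ (bit f + 2 * b) ⊕ (bit (not e) + 2 * (m ∸ suc a)) ⊕ (bit (not f) + 2 * (m ∸ suc b))
    ≡⟨ ⊕-complementary-bits e f a b (m ∸ suc a) (m ∸ suc b) ⟩
  2 * nimSum m (suc a) (suc b) ∎
  where open ≡-Reasoning

InP-child⇔InP : ∀ {m} e a f b → InP (2 * m) (child e a) (child f b) ⇔ InP m (suc a) (suc b)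
InP-child⇔InP e a f b = mk⇔
  (λ (_ , child-e≤2m , _ , child-f≤2m , nimSum≡0) →
    let a<m = Equivalence.to (child≤double⇔< e) child-e≤2m
        b<m = Equivalence.to (child≤double⇔< f) child-f≤2m
    in s≤s z≤n , a<m , s≤s z≤n , b<m , *-cancelˡ-≡ _ 0 2 (trans (sym (nimSum-child e f a<m b<m)) nimSum≡0))
  (λ (_ , a<m , _ , b<m , nimSum≡0) →
    s≤s z≤n , Equivalence.from (child≤double⇔< e) a<m , s≤s z≤n , Equivalence.from (child≤double⇔< f) b<m ,
    trans (nimSum-child e f a<m b<m) (cong (2 *_) nimSum≡0))

ℚ-ring : AlmostCommutativeRing 0ℓ 0ℓ
ℚ-ring = fromCommutativeRing ℚₚ.+-*-commutativeRing (λ p → dec⇒maybe (0ℚ ℚₚ.≟ p))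

toℚᵘ-ℕ→ℚ : ∀ n → ℚ.toℚᵘ (ℕ→ℚ n) ℚᵘ.≃ ℚᵘ.mkℚᵘ (ℤ.+ n) 0
toℚᵘ-ℕ→ℚ n = ℚₚ.toℚᵘ-fromℚᵘ (ℚᵘ.mkℚᵘ (ℤ.+ n) 0)

ℕ→ℚ-homo-+ : ∀ m n → ℕ→ℚ (m + n) ≡ ℕ→ℚ m ℚ.+ ℕ→ℚ n
ℕ→ℚ-homo-+ m n = ℚₚ.toℚᵘ-injective (begin
  ℚ.toℚᵘ (ℕ→ℚ (m + n))                          ≈⟨ toℚᵘ-ℕ→ℚ (m + n) ⟩
  ℚᵘ.mkℚᵘ (ℤ.+ (m + n)) 0                       ≈⟨ ℚᵘ.*≡* (cong (ℤ._* ℤ.+ 1) +[m+n]≡+m*1++n*1) ⟩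
  ℚᵘ.mkℚᵘ (ℤ.+ m) 0 ℚᵘ.+ ℚᵘ.mkℚᵘ (ℤ.+ n) 0      ≈⟨ ℚᵘₚ.+-cong (toℚᵘ-ℕ→ℚ m) (toℚᵘ-ℕ→ℚ n) ⟨
  ℚ.toℚᵘ (ℕ→ℚ m) ℚᵘ.+ ℚ.toℚᵘ (ℕ→ℚ n)            ≈⟨ ℚₚ.toℚᵘ-homo-+ (ℕ→ℚ m) (ℕ→ℚ n) ⟨
  ℚ.toℚᵘ (ℕ→ℚ m ℚ.+ ℕ→ℚ n)                      ∎)
  where
  open ℚᵘₚ.≃-Reasoning
  +[m+n]≡+m*1++n*1 : ℤ.+ (m + n) ≡ ℤ.+ m ℤ.* ℤ.+ 1 ℤ.+ ℤ.+ n ℤ.* ℤ.+ 1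
  +[m+n]≡+m*1++n*1 = trans (ℤ.pos-+ m n) (sym (cong₂ ℤ._+_ (ℤ.*-identityʳ (ℤ.+ m)) (ℤ.*-identityʳ (ℤ.+ n))))

ℕ→ℚ-double : ∀ n → ℕ→ℚ (2 * n) ≡ ℕ→ℚ 2 ℚ.* ℕ→ℚ n
ℕ→ℚ-double n = begin
  ℕ→ℚ (n + (n + 0))         ≡⟨ trans (ℕ→ℚ-homo-+ n (n + 0)) (cong (ℕ→ℚ n ℚ.+_) (ℕ→ℚ-homo-+ n 0)) ⟩
  ℕ→ℚ n ℚ.+ (ℕ→ℚ n ℚ.+ 0ℚ)  ≡⟨ x+[x+0]≡2x (ℕ→ℚ n) ⟩
  ℕ→ℚ 2 ℚ.* ℕ→ℚ n           ∎
  where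
  open ≡-Reasoning
  x+[x+0]≡2x : ∀ x → x ℚ.+ (x ℚ.+ 0ℚ) ≡ ℕ→ℚ 2 ℚ.* x
  x+[x+0]≡2x = solve-∀ ℚ-ring

child-offset : ∀ e a x →
  ℕ→ℚ (child e a) ℚ.- (ℕ→ℚ 2 ℚ.* x ℚ.- ℕ→ℚ (bit (not e))) ≡ ℕ→ℚ 2 ℚ.* (ℕ→ℚ (suc a) ℚ.- x)
child-offset e a x = begin
  ℕ→ℚ (child e a) ℚ.- (ℕ→ℚ 2 ℚ.* x ℚ.- ℕ→ℚ (bit (not e)))  ≡⟨ regroup (ℕ→ℚ (child e a)) _ x ⟩
  ℕ→ℚ (child e a) ℚ.+ ℕ→ℚ (bit (not e)) ℚ.- ℕ→ℚ 2 ℚ.* x    ≡⟨ cong (ℚ._- ℕ→ℚ 2 ℚ.* x) ℕ→ℚ-child+bit-not ⟩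
  ℕ→ℚ 2 ℚ.* ℕ→ℚ (suc a) ℚ.- ℕ→ℚ 2 ℚ.* x                    ≡⟨ factor-2 (ℕ→ℚ (suc a)) x ⟩
  ℕ→ℚ 2 ℚ.* (ℕ→ℚ (suc a) ℚ.- x)                            ∎
  where
  open ≡-Reasoning
  regroup : ∀ c b x → c ℚ.- (ℕ→ℚ 2 ℚ.* x ℚ.- b) ≡ c ℚ.+ b ℚ.- ℕ→ℚ 2 ℚ.* x
  regroup = solve-∀ ℚ-ring
  factor-2 : ∀ s x → ℕ→ℚ 2 ℚ.* s ℚ.- ℕ→ℚ 2 ℚ.* x ≡ ℕ→ℚ 2 ℚ.* (s ℚ.- x)
  factor-2 = solve-∀ ℚ-ring
  ℕ→ℚ-child+bit-not : ℕ→ℚ (child e a) ℚ.+ ℕ→ℚ (bit (not e)) ≡ ℕ→ℚ 2 ℚ.* ℕ→ℚ (suc a)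
  ℕ→ℚ-child+bit-not = begin
    ℕ→ℚ (child e a) ℚ.+ ℕ→ℚ (bit (not e))  ≡⟨ ℕ→ℚ-homo-+ (child e a) (bit (not e)) ⟨
    ℕ→ℚ (child e a + bit (not e))          ≡⟨ cong ℕ→ℚ (child+bit-not e a) ⟩
    ℕ→ℚ (2 * suc a)                        ≡⟨ ℕ→ℚ-double (suc a) ⟩
    ℕ→ℚ 2 ℚ.* ℕ→ℚ (suc a)                  ∎

InUnitInterval : ℚ → Set
InUnitInterval x = 0ℚ ℚ.≤ x × x ℚ.≤ 1ℚ

Cell : ℕ → ℚ → Set
Cell i u = ∃[ x ] InUnitInterval x × u ≡ ℕ→ℚ i ℚ.- x

bit∈[0,1] : ∀ b → InUnitInterval (ℕ→ℚ (bit b))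
bit∈[0,1] false = ℚₚ.≤-refl , ℚₚ.nonNegative⁻¹ 1ℚ
bit∈[0,1] true  = ℚₚ.nonNegative⁻¹ 1ℚ , ℚₚ.≤-refl

midpoint∈[0,1] : ∀ {p q} → InUnitInterval p → InUnitInterval q → InUnitInterval (½ ℚ.* (p ℚ.+ q))
midpoint∈[0,1] (0≤p , p≤1) (0≤q , q≤1) =
  ℚₚ.*-monoˡ-≤-nonNeg ½ (ℚₚ.+-mono-≤ 0≤p 0≤q) , ℚₚ.*-monoˡ-≤-nonNeg ½ (ℚₚ.+-mono-≤ p≤1 q≤1)

cell-child⇒double : ∀ e a {u} → Cell (child e a) u → ∃[ x ] Cell (suc a) x × u ≡ ℕ→ℚ 2 ℚ.* x
cell-child⇒double e a (x₀ , x₀∈[0,1] , refl) =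
  ℕ→ℚ (suc a) ℚ.- x₁ , (x₁ , midpoint∈[0,1] (bit∈[0,1] (not e)) x₀∈[0,1] , refl) , (begin
    ℕ→ℚ (child e a) ℚ.- x₀                     ≡⟨ cong (λ y → ℕ→ℚ (child e a) ℚ.- y) (x≡2[½[b+x]]-b b x₀) ⟩
    ℕ→ℚ (child e a) ℚ.- (ℕ→ℚ 2 ℚ.* x₁ ℚ.- b)  ≡⟨ child-offset e a x₁ ⟩
    ℕ→ℚ 2 ℚ.* (ℕ→ℚ (suc a) ℚ.- x₁)            ∎)
  where
  open ≡-Reasoning
  b x₁ : ℚ
  b  = ℕ→ℚ (bit (not e))
  x₁ = ½ ℚ.* (b ℚ.+ x₀)
  x≡2[½[b+x]]-b : ∀ b x → x ≡ ℕ→ℚ 2 ℚ.* (½ ℚ.* (b ℚ.+ x)) ℚ.- b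
  x≡2[½[b+x]]-b = solve-∀ ℚ-ring

-- The child offset is x₀ = 2 x₁ - bit (not e); the child is chosen so that x₀ ∈ [0,1].
cell-double⇒child : ∀ a {x} → Cell (suc a) x → ∃[ e ] Cell (child e a) (ℕ→ℚ 2 ℚ.* x)
cell-double⇒child a (x₁ , (0≤x₁ , x₁≤1) , refl) with x₁ ℚₚ.≤? ½
... | yes x₁≤½ = true , ℕ→ℚ 2 ℚ.* x₁ ℚ.- 0ℚ ,
  (ℚₚ.+-monoˡ-≤ (ℚ.- 0ℚ) (ℚₚ.*-monoˡ-≤-nonNeg (ℕ→ℚ 2) 0≤x₁) ,
   ℚₚ.+-monoˡ-≤ (ℚ.- 0ℚ) (ℚₚ.*-monoˡ-≤-nonNeg (ℕ→ℚ 2) x₁≤½)) ,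
  sym (child-offset true a x₁)
... | no  x₁≰½ = false , ℕ→ℚ 2 ℚ.* x₁ ℚ.- 1ℚ ,
  (ℚₚ.+-monoˡ-≤ (ℚ.- 1ℚ) (ℚₚ.*-monoˡ-≤-nonNeg (ℕ→ℚ 2) (ℚₚ.<⇒≤ (ℚₚ.≰⇒> x₁≰½))) ,
   ℚₚ.+-monoˡ-≤ (ℚ.- 1ℚ) (ℚₚ.*-monoˡ-≤-nonNeg (ℕ→ℚ 2) x₁≤1)) ,
  sym (child-offset false a x₁)

R-intro : ∀ {m i j u v} → InP m i j → Cell i u → Cell j v → R m (u , v)
R-intro P (x , (0≤x , x≤1) , u≡) (y , (0≤y , y≤1) , v≡) = _ , _ , x , y , P , 0≤x , x≤1 , 0≤y , y≤1 , u≡ , v≡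

scale-intro : ∀ {r m i j u v} → InP m i j →
  (∃[ x ] Cell i x × u ≡ r ℚ.* x) → (∃[ y ] Cell j y × v ≡ r ℚ.* y) → scale r (R m) (u , v)
scale-intro P (x , cx , u≡) (y , cy , v≡) = x , y , R-intro P cx cy , u≡ , v≡

R-double⇒scaled : ∀ m {u v} → R (2 * m) (u , v) → scale (ℕ→ℚ 2) (R m) (u , v)
R-double⇒scaled m (i , j , x , y , P@(1≤i , _ , 1≤j , _ , _) , 0≤x , x≤1 , 0≤y , y≤1 , u≡ , v≡)
  with child-surjective 1≤i | child-surjective 1≤j
... | e , a , refl | f , b , refl =
  scale-intro {ℕ→ℚ 2} (Equivalence.to (InP-child⇔InP e a f b) P)
    (cell-child⇒double e a (x , (0≤x , x≤1) , u≡)) (cell-child⇒double f b (y , (0≤y , y≤1) , v≡))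

R-double-intro : ∀ {m a b u v} → InP m (suc a) (suc b) →
  ∃[ e ] Cell (child e a) u → ∃[ f ] Cell (child f b) v → R (2 * m) (u , v)
R-double-intro {a = a} {b} P (e , cu) (f , cv) = R-intro (Equivalence.from (InP-child⇔InP e a f b) P) cu cv

scaled⇒R-double : ∀ m {u v} → scale (ℕ→ℚ 2) (R m) (u , v) → R (2 * m) (u , v)
scaled⇒R-double m (x , y , (suc a , suc b , x₁ , y₁ , P@(s≤s z≤n , _ , s≤s z≤n , _ , _) ,
                           0≤x₁ , x₁≤1 , 0≤y₁ , y₁≤1 , x≡ , y≡) , refl , refl) =
  R-double-intro P (cell-double⇒child a (x₁ , (0≤x₁ , x₁≤1) , x≡)) (cell-double⇒child b (y₁ , (0≤y₁ , y₁≤1) , y≡))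

theorem2 : (m : ℕ) → 1 ≤ m → (p : Point) →
    R (2 * m) p ⇔ scale (ℕ→ℚ 2) (R m) p
theorem2 m _ (u , v) = mk⇔ (R-double⇒scaled m) (scaled⇒R-double m)
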